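{- Let $k\geq 1$ be an integer and, for $n\geq 3$, let $C^k_n$ be the $k$-th power of the cycle $C_n$. Then $n_\mathscr{D}(C^k_i)=2$ for $3\leq i\leq 2k+1$, $n_\mathscr{D}(C^k_j)=2+j(j-2k-1)$ for $2k+2\leq j\leq 2k+4$, and, for $n\geq 2k+5$, $$n_\mathscr{D}(C^k_n)=2n_\mathscr{D}(C^k_{n-1})-n_\mathscr{D}(C^k_{n-2})+n_\mathscr{D}(C^k_{n-2k-2}).$$
   Context: For a graph $G$ and $v\in V(G)$, $N[v]$ is the closed neighbourhood of $v$ (the neighbours of $v$ together with $v$), and for $S\subseteq V(G)$, $N[S]=\bigcup_{v\in S}N[v]$. A set $S\subseteq V(G)$ is digitally convex if for every $v\in V(G)$, $N[v]\subseteq N[S]$ implies $v\in S$ (in particular $\emptyset$ and $V(G)$ are digitally convex). $n_\mathscr{D}(G)$ denotes the number of digitally convex subsets of $V(G)$. The $k$-th power $G^k$ of a graph $G$ has vertex set $V(G)$, with $u\neq v$ adjacent iff their distance in $G$ is at most $k$. $C_n$ is the cycle on $n$ vertices. -}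

module Defs where

open import Data.Nat using (ℕ; zero; suc; _+_; _∸_; _≤_; _≤?_; _⊓_)
open import Data.Fin using (Fin; toℕ; _≟_)
open import Data.Fin.Subset using (Subset; _∈_; _∉_)
open import Data.Fin.Subset.Properties using (_∈?_)
open import Data.Fin.Properties using (all?; any?)
open import Data.Vec using (Vec; []; _∷_)
open import Data.List using (List; []; _∷_; map; _++_; filter; length)
open import Data.Bool using (Bool; true; false)
open import Data.Product using (Σ; _×_; _,_; ∃)
open import Data.Sum using (_⊎_)
open import Relation.Nullary using (Dec; ¬_)
open import Relation.Nullary.Decidable using (_⊎-dec_; _×-dec_; _→-dec_; ¬?)
open import Relation.Binary.PropositionalEquality using (_≡_)
open import Relation.Binary using (Rel; Decidable)

record Graph (n : ℕ) : Set₁ where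
  field
    Adj  : Rel (Fin n) _
    adj? : Decidable Adj

module _ {n : ℕ} (G : Graph n) where
  open Graph G

  InN : Fin n → Fin n → Set
  InN v u = (u ≡ v) ⊎ Adj v u

  inN? : ∀ v u → Dec (InN v u)
  inN? v u = (u ≟ v) ⊎-dec adj? v u

  InNS : Subset n → Fin n → Set
  InNS S u = ∃ λ v → v ∈ S × InN v u

  inNS? : ∀ S u → Dec (InNS S u)
  inNS? S u = any? (λ v → (v ∈? S) ×-dec inN? v u)

  DigitallyConvex : Subset n → Set
  DigitallyConvex S = ∀ v → (∀ u → InN v u → InNS S u) → v ∈ S

  digitallyConvex? : ∀ S → Dec (DigitallyConvex S)
  digitallyConvex? S =
    all? (λ v → all? (λ u → inN? v u →-dec inNS? S u) →-dec (v ∈? S))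

allSubsets : (m : ℕ) → List (Subset m)
allSubsets zero    = [] ∷ []
allSubsets (suc m) = map (false ∷_) (allSubsets m) ++ map (true ∷_) (allSubsets m)

nD : ∀ {n} → Graph n → ℕ
nD {n} G = length (filter (digitallyConvex? G) (allSubsets n))

cycleDist : ∀ {n} → Fin n → Fin n → ℕ
cycleDist {n} i j = d ⊓ (n ∸ d)
  where
  d = (toℕ i ∸ toℕ j) + (toℕ j ∸ toℕ i)

cyclePow : (n k : ℕ) → Graph n
cyclePow n k = record
  { Adj  = λ u v → ¬ (u ≡ v) × cycleDist u v ≤ k
  ; adj? = λ u v → ¬? (u ≟ v) ×-dec (cycleDist u v ≤? k)
  }

-- A set S is digitally convex iff every vertex outside S has a neighbour whose closed neighbourhood misses S.
-- In C_n^k the closed neighbourhoods are the cyclic windows of w = 2k + 1 consecutive vertices, so for n ≥ w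
-- the indicator word of S is convex iff every zero lies in a cyclic block of w zeros, i.e. iff every maximal
-- cyclic run of zeros is empty or has length at least w; for n ≤ w only ∅ and V(G) are convex. Rotating the
-- word so that it ends with a one turns this into a condition on linear runs, checked by an automaton that
-- tracks the length of the current run. Counting accepted words gives n_D(C_n^k) = 2E(n) + 2k S(n - w), where
-- E(m + 1) = E(m) + S(m + 1 - w) and S(m + 1) = S(m) + E(m) (E m = closed m 0, S m = closed m w below);
-- the small values and the recurrence follow from these two relations.

module Submission where

open import Defs
open import Data.Bool using (Bool; true; false; if_then_else_; not; _∧_; _∨_)
open import Data.Bool.ListAction using (all; and)
open import Data.Bool.Properties using (T-≡; ∨-identityʳ; ∨-zeroʳ) renaming (_≟_ to _≟ᵇ_)
open import Data.Fin using (Fin; toℕ; fromℕ<) renaming (_≟_ to _≟ᶠ_)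
open import Data.Fin.Properties using (toℕ<n; toℕ-fromℕ<; any?)
open import Data.Fin.Subset using (Subset; _∈_)
open import Data.List using (List; []; _∷_; _++_; map; filter; length; replicate)
open import Data.List.Properties using (length-++; filter-++; length-replicate)
open import Data.Nat using (ℕ; zero; suc; _+_; _*_; _∸_; _≤_; _<_; _⊓_; z≤n; s≤s; s≤s⁻¹; _≤?_; _<?_; NonZero; _%_; _/_)
open import Data.Nat.DivMod using (%-distribˡ-+; m%n%n≡m%n; m≡m%n+[m/n]*n; m%n≤n; m%n<n; [m+kn]%n≡m%n; [m+n]%n≡m%n; m<n⇒m%n≡m; m<n*o⇒m/o<n)
open import Data.Nat.Properties
open import Algebra.Properties.CommutativeSemigroup +-commutativeSemigroup using () renaming (xy∙z≈xz∙y to +-right-comm)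
open import Data.Nat.Tactic.RingSolver using (solve-∀)
open import Data.Product using (∃; ∃₂; _×_; _,_)
open import Data.Sum using (_⊎_; inj₁; inj₂)
open import Data.Vec using (Vec; toList; lookup) renaming ([] to []ᵛ; _∷_ to _∷ᵛ_)
open import Data.Vec.Properties using ([]=⇒lookup; lookup⇒[]=; length-toList)
open import Function using (_∘_; _⇔_; mk⇔)
open import Function.Properties.Equivalence using () renaming (trans to ⇔-trans; sym to ⇔-sym)
open import Relation.Binary.Definitions using (tri<; tri≈; tri>)
open import Relation.Binary.PropositionalEquality
open import Relation.Nullary using (Dec; yes; no; does; ¬?; contradiction)
open import Relation.Nullary.Decidable using (T?; does-⇔; dec-true; dec-false; _×-dec_)
open import Relation.Unary using (Pred; Decidable)

-- Counting Boolean vectors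

count : (n : ℕ) → (Vec Bool n → Bool) → ℕ
count zero    p = if p []ᵛ then 1 else 0
count (suc n) p = count n (p ∘ (false ∷ᵛ_)) + count n (p ∘ (true ∷ᵛ_))

count-cong : ∀ n {p q : Vec Bool n → Bool} → (∀ v → p v ≡ q v) → count n p ≡ count n q
count-cong zero    p≗q rewrite p≗q []ᵛ = refl
count-cong (suc n) p≗q = cong₂ _+_ (count-cong n (p≗q ∘ (false ∷ᵛ_))) (count-cong n (p≗q ∘ (true ∷ᵛ_)))

count-false : ∀ n → count n (λ _ → false) ≡ 0
count-false zero    = refl
count-false (suc n) rewrite count-false n = refl

count-∧ : ∀ n b (p : Vec Bool n → Bool) → count n (λ v → b ∧ p v) ≡ (if b then count n p else 0)
count-∧ n true  p = refl
count-∧ n false p = count-false n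

length-filter-map : ∀ {a b p} {A : Set a} {B : Set b} {P : Pred B p} (P? : Decidable P) (f : A → B) xs →
                    length (filter P? (map f xs)) ≡ length (filter (P? ∘ f) xs)
length-filter-map P? f []       = refl
length-filter-map P? f (x ∷ xs) with does (P? (f x))
... | true  = cong suc (length-filter-map P? f xs)
... | false = length-filter-map P? f xs

length-filter-allSubsets : ∀ n {p} {P : Pred (Vec Bool n) p} (P? : Decidable P) →
                           length (filter P? (allSubsets n)) ≡ count n (does ∘ P?)
length-filter-allSubsets zero    P? with does (P? []ᵛ)
... | true  = refl
... | false = refl
length-filter-allSubsets (suc n) P? = begin
  length (filter P? (map (false ∷ᵛ_) subsets ++ map (true ∷ᵛ_) subsets))
    ≡⟨ cong length (filter-++ P? (map (false ∷ᵛ_) subsets) _) ⟩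
  length (filter P? (map (false ∷ᵛ_) subsets) ++ filter P? (map (true ∷ᵛ_) subsets))
    ≡⟨ length-++ (filter P? (map (false ∷ᵛ_) subsets)) ⟩
  length (filter P? (map (false ∷ᵛ_) subsets)) + length (filter P? (map (true ∷ᵛ_) subsets))
    ≡⟨ cong₂ _+_ (length-filter-map P? (false ∷ᵛ_) subsets) (length-filter-map P? (true ∷ᵛ_) subsets) ⟩
  length (filter (P? ∘ (false ∷ᵛ_)) subsets) + length (filter (P? ∘ (true ∷ᵛ_)) subsets)
    ≡⟨ cong₂ _+_ (length-filter-allSubsets n (P? ∘ (false ∷ᵛ_))) (length-filter-allSubsets n (P? ∘ (true ∷ᵛ_))) ⟩
  count (suc n) (does ∘ P?) ∎
  where
  open ≡-Reasoning
  subsets = allSubsets n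

length-filter-allSubsets-⇔ : ∀ n {p} {P : Pred (Subset n) p} (P? : Decidable P) (b : Subset n → Bool) →
                             (∀ S → P S ⇔ (b S ≡ true)) → length (filter P? (allSubsets n)) ≡ count n b
length-filter-allSubsets-⇔ n P? b P⇔b = trans (length-filter-allSubsets n P?)
  (count-cong n (λ S → does-⇔ (⇔-trans (P⇔b S) (⇔-sym T-≡)) (P? S) (T? (b S))))

-- Positions past the end read as a one.
letter : List Bool → ℕ → Bool
letter []      _       = true
letter (b ∷ l) zero    = b
letter (b ∷ l) (suc i) = letter l i

letter-++ˡ : ∀ u {x} i → i < length u → letter (u ++ x) i ≡ letter u i
letter-++ˡ (b ∷ u) zero    _         = refl
letter-++ˡ (b ∷ u) (suc i) (s≤s i<u) = letter-++ˡ u i i<u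

letter-++ʳ : ∀ u {x} j → letter (u ++ x) (length u + j) ≡ letter x j
letter-++ʳ []      j = refl
letter-++ʳ (b ∷ u) j = letter-++ʳ u j

letter-beyond : ∀ l {i} → length l ≤ i → letter l i ≡ true
letter-beyond []          _         = refl
letter-beyond (b ∷ l) {suc i} (s≤s l≤i) = letter-beyond l l≤i

letter-zeros : ∀ c {i} → i < c → letter (replicate c false) i ≡ false
letter-zeros (suc c) {zero}  _         = refl
letter-zeros (suc c) {suc i} (s≤s i<c) = letter-zeros c i<c

letter-zeros++ : ∀ c {x} {i} → i < c → letter (replicate c false ++ x) i ≡ false
letter-zeros++ (suc c) {i = zero}  _         = refl
letter-zeros++ (suc c) {i = suc i} (s≤s i<c) = letter-zeros++ c i<c

letter-after-zeros : ∀ c x j → letter (replicate c false ++ x) (c + j) ≡ letter x j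
letter-after-zeros zero    x j = refl
letter-after-zeros (suc c) x j = letter-after-zeros c x j

letter-one : ∀ c x → letter (replicate c false ++ true ∷ x) c ≡ true
letter-one c x = trans (cong (letter (replicate c false ++ true ∷ x)) (sym (+-identityʳ c))) (letter-after-zeros c (true ∷ x) 0)

letter-after-one : ∀ c x i → letter (replicate c false ++ true ∷ x) (suc (c + i)) ≡ letter x i
letter-after-one c x i = trans (cong (letter (replicate c false ++ true ∷ x)) (sym (+-suc c i))) (letter-after-zeros c (true ∷ x) (suc i))

zeros-∷ : ∀ c (x : List Bool) → replicate c false ++ false ∷ x ≡ replicate (suc c) false ++ x
zeros-∷ zero    x = refl
zeros-∷ (suc c) x = cong (false ∷_) (zeros-∷ c x)

∧-≡-true : ∀ {a b} → a ∧ b ≡ true → a ≡ true × b ≡ true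
∧-≡-true {true} {true} _ = refl , refl

constant : List Bool → Bool
constant L = all not L ∨ and L

all-not⇒absent : ∀ L → all not L ≡ true → ∀ {i} → i < length L → letter L i ≡ false
all-not⇒absent (false ∷ L) ok {zero}  _         = refl
all-not⇒absent (false ∷ L) ok {suc i} (s≤s i<L) = all-not⇒absent L ok i<L

absent⇒all-not : ∀ L → (∀ {i} → i < length L → letter L i ≡ false) → all not L ≡ true
absent⇒all-not []          _      = refl
absent⇒all-not (true  ∷ L) absent with absent {0} (s≤s z≤n)
... | ()
absent⇒all-not (false ∷ L) absent = absent⇒all-not L (λ i<L → absent (s≤s i<L))

and⇒present : ∀ L → and L ≡ true → ∀ {i} → i < length L → letter L i ≡ true
and⇒present (true ∷ L) ok {zero}  _         = refl
and⇒present (true ∷ L) ok {suc i} (s≤s i<L) = and⇒present L ok i<L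

¬and⇒absent : ∀ L → and L ≡ false → ∃ λ y → y < length L × letter L y ≡ false
¬and⇒absent (false ∷ L) _  = 0 , s≤s z≤n , refl
¬and⇒absent (true  ∷ L) ok with ¬and⇒absent L ok
... | y , y<L , Ly≡false = suc y , s≤s y<L , Ly≡false

∨-≡-true : ∀ {a b} → a ∨ b ≡ true → a ≡ true ⊎ b ≡ true
∨-≡-true {true}  _  = inj₁ refl
∨-≡-true {false} ok = inj₂ ok

lookup≡letter : ∀ {n} (S : Vec Bool n) x → lookup S x ≡ letter (toList S) (toℕ x)
lookup≡letter (b ∷ᵛ S) Fin.zero    = refl
lookup≡letter (b ∷ᵛ S) (Fin.suc x) = lookup≡letter S x

count-all-not : ∀ n → count n (all not ∘ toList) ≡ 1
count-all-not zero    = refl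
count-all-not (suc n) rewrite count-all-not n | count-false n = refl

count-and : ∀ n → count n (and ∘ toList) ≡ 1
count-and zero    = refl
count-and (suc n) rewrite count-and n | count-false n = refl

count-constant : ∀ n → count (suc n) (constant ∘ toList) ≡ 2
count-constant n
  rewrite count-cong n {λ v → all not (toList v) ∨ false} (λ v → ∨-identityʳ (all not (toList v)))
        | count-all-not n | count-and n = refl

module _ {n : ℕ} .{{_ : NonZero n}} where

  open ≡-Reasoning

  %-+ˡ : ∀ a b → (a % n + b) % n ≡ (a + b) % n
  %-+ˡ a b = begin
    (a % n + b) % n         ≡⟨ %-distribˡ-+ (a % n) b n ⟩
    (a % n % n + b % n) % n ≡⟨ cong (λ x → (x + b % n) % n) (m%n%n≡m%n a n) ⟩
    (a % n + b % n) % n     ≡⟨ %-distribˡ-+ a b n ⟨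
    (a + b) % n             ∎

  %-+ʳ : ∀ a b → (a + b % n) % n ≡ (a + b) % n
  %-+ʳ a b = begin
    (a + b % n) % n ≡⟨ cong (_% n) (+-comm a (b % n)) ⟩
    (b % n + a) % n ≡⟨ %-+ˡ b a ⟩
    (b + a) % n     ≡⟨ cong (_% n) (+-comm b a) ⟩
    (a + b) % n     ∎

  +-complement-% : ∀ r x → (x + (r + (n ∸ r % n))) % n ≡ x % n
  +-complement-% r x = begin
    (x + (r + (n ∸ r % n))) % n                 ≡⟨ cong (λ y → (x + (y + (n ∸ r % n))) % n) (m≡m%n+[m/n]*n r n) ⟩
    (x + (r % n + (r / n) * n + (n ∸ r % n))) % n ≡⟨ cong (λ y → (x + y) % n) (shuffle (r % n) ((r / n) * n) (n ∸ r % n)) ⟩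
    (x + (r % n + (n ∸ r % n) + (r / n) * n)) % n ≡⟨ cong (λ y → (x + (y + (r / n) * n)) % n) (m+[n∸m]≡n (m%n≤n r n)) ⟩
    (x + suc (r / n) * n) % n                   ≡⟨ [m+kn]%n≡m%n x (suc (r / n)) n ⟩
    x % n                                       ∎
    where
    shuffle : ∀ a b c → a + b + c ≡ a + c + b
    shuffle = solve-∀

  +-cancelˡ-% : ∀ r a b → (r + a) % n ≡ (r + b) % n → a % n ≡ b % n
  +-cancelˡ-% r a b eq = begin
    a % n                       ≡⟨ +-complement-% r a ⟨
    (a + (r + c)) % n           ≡⟨ cong (_% n) (shuffle a r c) ⟩
    ((r + a) + c) % n           ≡⟨ %-+ˡ (r + a) c ⟨
    ((r + a) % n + c) % n       ≡⟨ cong (λ y → (y + c) % n) eq ⟩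
    ((r + b) % n + c) % n       ≡⟨ %-+ˡ (r + b) c ⟩
    ((r + b) + c) % n           ≡⟨ cong (_% n) (shuffle b r c) ⟨
    (b + (r + c)) % n           ≡⟨ +-complement-% r b ⟩
    b % n                       ∎
    where
    c = n ∸ r % n
    shuffle : ∀ a r c → a + (r + c) ≡ r + a + c
    shuffle = solve-∀

  +-congˡ-% : ∀ r {a b} → a % n ≡ b % n → (r + a) % n ≡ (r + b) % n
  +-congˡ-% r {a} {b} eq = begin
    (r + a) % n     ≡⟨ %-+ʳ r a ⟨
    (r + a % n) % n ≡⟨ cong (λ y → (r + y) % n) eq ⟩
    (r + b % n) % n ≡⟨ %-+ʳ r b ⟩
    (r + b) % n     ∎

dist : ℕ → ℕ → ℕ → ℕ
dist n u z = ((u ∸ z) + (z ∸ u)) ⊓ (n ∸ ((u ∸ z) + (z ∸ u)))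

dist-self : ∀ n u → dist n u u ≡ 0
dist-self n u rewrite n∸n≡0 u = refl

dist-sym : ∀ n u z → dist n u z ≡ dist n z u
dist-sym n u z rewrite +-comm (u ∸ z) (z ∸ u) = refl

dist-≤-small : ∀ {n k} u z → n ≤ suc (k + k) → dist n u z ≤ k
dist-≤-small {n} {k} u z n≤ with (u ∸ z) + (z ∸ u) ≤? k
... | yes d≤k = ≤-trans (m⊓n≤m _ _) d≤k
... | no  d≰k = ≤-trans (m⊓n≤n _ _) (m≤n+o⇒m∸n≤o n _ (≤-trans n≤ (+-monoˡ-≤ k (≰⇒> d≰k))))

dist-cases : ∀ n u z → (∃ λ d → z ≡ u + d × dist n u z ≡ d ⊓ (n ∸ d))
                     ⊎ (∃ λ d → u ≡ z + suc d × dist n u z ≡ suc d ⊓ (n ∸ suc d))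
dist-cases n u z with u ≤? z
... | yes u≤z rewrite m≤n⇒m∸n≡0 u≤z = inj₁ (z ∸ u , sym (m+[n∸m]≡n u≤z) , refl)
... | no  u≰z rewrite m≤n⇒m∸n≡0 (<⇒≤ (≰⇒> u≰z)) | +-identityʳ (u ∸ z) | +-∸-assoc 1 (≰⇒> u≰z) =
  inj₂ (u ∸ suc z , trans (sym (m+[n∸m]≡n (<⇒≤ (≰⇒> u≰z)))) (cong (z +_) (+-∸-assoc 1 (≰⇒> u≰z))) , refl)

⊓-≤-cases : ∀ {x y k} → x ⊓ y ≤ k → x ≤ k ⊎ y ≤ k
⊓-≤-cases {x} {y} {k} x⊓y≤k with ⊓-sel x y
... | inj₁ x⊓y≡x = inj₁ (subst (_≤ k) x⊓y≡x x⊓y≤k)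
... | inj₂ x⊓y≡y = inj₂ (subst (_≤ k) x⊓y≡y x⊓y≤k)

module _ {k b : ℕ} (k<b : k < b) where

  open ≤-Reasoning

  private
    n = k + b

    ⊓-≤ʳ : ∀ {d} → n ≤ d + k → d ⊓ (n ∸ d) ≤ k
    ⊓-≤ʳ {d} n≤d+k = ≤-trans (m⊓n≤n d _) (m≤n+o⇒m∸n≤o n d n≤d+k)

    ⊓-≤ˡ : ∀ {d} → d ≤ k → d ⊓ (n ∸ d) ≤ k
    ⊓-≤ˡ d≤k = ≤-trans (m⊓n≤m _ _) d≤k

  window-sound-ahead : ∀ {d t} q → t ≤ k + k → q < 3 → b + t ≡ d + q * n → d ⊓ (n ∸ d) ≤ k
  window-sound-ahead {d} {t} 0 _ _ eq = ⊓-≤ʳ (begin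
    k + b     ≤⟨ m≤m+n (k + b) t ⟩
    k + b + t ≡⟨ shuffle k b t ⟩
    b + t + k ≡⟨ cong (_+ k) eq ⟩
    d + 0 + k ≡⟨ cong (_+ k) (+-identityʳ d) ⟩
    d + k     ∎)
    where
    shuffle : ∀ k b t → k + b + t ≡ b + t + k
    shuffle = solve-∀
  window-sound-ahead {d} {t} 1 t≤2k _ eq = ⊓-≤ˡ (+-cancelʳ-≤ k d k (begin
    d + k ≡⟨ +-cancelˡ-≡ b (d + k) t (trans (shuffle d k b) (sym eq)) ⟩
    t     ≤⟨ t≤2k ⟩
    k + k ∎))
    where
    shuffle : ∀ d k b → b + (d + k) ≡ d + 1 * (k + b)
    shuffle = solve-∀
  window-sound-ahead {d} {t} 2 t≤2k _ eq = contradiction t≤2k (<⇒≱ (begin-strict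
    k + k           <⟨ m<m+n (k + k) (≤-trans (s≤s z≤n) k<b) ⟩
    k + k + b       ≤⟨ m≤n+m (k + k + b) d ⟩
    d + (k + k + b) ≡⟨ +-cancelˡ-≡ b _ t (trans (shuffle d k b) (sym eq)) ⟩
    t               ∎))
    where
    shuffle : ∀ d k b → b + (d + (k + k + b)) ≡ d + 2 * (k + b)
    shuffle = solve-∀
  window-sound-ahead (suc (suc (suc _))) _ (s≤s (s≤s (s≤s ()))) _

  window-sound-behind : ∀ {d t} q → t ≤ k + k → q < 3 → suc d + b + t ≡ q * n → suc d ⊓ (n ∸ suc d) ≤ k
  window-sound-behind 0 _ _ ()
  window-sound-behind {d} {t} 1 _ _ eq = ⊓-≤ˡ (begin
    suc d     ≤⟨ m≤m+n (suc d) t ⟩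
    suc d + t ≡⟨ +-cancelʳ-≡ b (suc d + t) k (trans (swap d t b) (trans eq (+-identityʳ (k + b)))) ⟩
    k         ∎)
    where
    swap : ∀ d t b → suc d + t + b ≡ suc d + b + t
    swap = solve-∀
  window-sound-behind {d} {t} 2 t≤2k _ eq = ⊓-≤ʳ (begin
    k + b     ≡⟨ +-comm k b ⟩
    b + k     ≤⟨ +-monoˡ-≤ k b≤d ⟩
    suc d + k ∎)
    where
    swap : ∀ d t b → suc d + t + b ≡ suc d + b + t
    swap = solve-∀
    double : ∀ k b → 2 * (k + b) ≡ k + k + b + b
    double = solve-∀
    e : suc d + t ≡ k + k + b
    e = +-cancelʳ-≡ b (suc d + t) (k + k + b) (trans (swap d t b) (trans eq (double k b)))
    b≤d : b ≤ suc d
    b≤d = +-cancelˡ-≤ (k + k) b (suc d) (begin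
      k + k + b       ≡⟨ e ⟨
      suc d + t       ≤⟨ +-monoʳ-≤ (suc d) t≤2k ⟩
      suc d + (k + k) ≡⟨ +-comm (suc d) (k + k) ⟩
      k + k + suc d   ∎)
  window-sound-behind (suc (suc (suc _))) _ (s≤s (s≤s (s≤s ()))) _

  window-sound : ∀ {u z t} q → t ≤ k + k → q < 3 → u + b + t ≡ z + q * n → dist n u z ≤ k
  window-sound {u} {z} {t} q t≤2k q<3 eq with dist-cases n u z
  ... | inj₁ (d , refl , dist≡) = subst (_≤ k) (sym dist≡) (window-sound-ahead q t≤2k q<3
          (+-cancelˡ-≡ u (b + t) (d + q * n) (trans (sym (+-assoc u b t)) (trans eq (+-assoc u d (q * n))))))
  ... | inj₂ (d , refl , dist≡) = subst (_≤ k) (sym dist≡) (window-sound-behind q t≤2k q<3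
          (+-cancelˡ-≡ z (suc d + b + t) (q * n) (trans (assoc z (suc d) b t) eq)))
    where
    assoc : ∀ z d b t → z + (d + b + t) ≡ z + d + b + t
    assoc = solve-∀

  window-complete : ∀ {u z} → u < n → z < n → dist n u z ≤ k → ∃₂ λ t q → t ≤ k + k × u + b + t ≡ z + q * n
  window-complete {u} {z} u<n z<n dist≤k with dist-cases n u z
  ... | inj₁ (d , refl , dist≡) with ⊓-≤-cases (subst (_≤ k) dist≡ dist≤k)
  ...   | inj₁ d≤k = k + d , 1 , +-monoʳ-≤ k d≤k , shuffle u b k d
    where
    shuffle : ∀ u b k d → u + b + (k + d) ≡ u + d + 1 * (k + b)
    shuffle = solve-∀
  ...   | inj₂ e≤k = k ∸ e , 0 , ≤-trans (m∸n≤m k e) (m≤m+n k k) , (begin-equality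
    u + b + (k ∸ e) ≡⟨ +-assoc u b (k ∸ e) ⟩
    u + (b + (k ∸ e)) ≡⟨ cong (u +_) (+-cancelˡ-≡ e _ _ (begin-equality
      e + (b + (k ∸ e)) ≡⟨ shuffle e b (k ∸ e) ⟩
      e + (k ∸ e) + b   ≡⟨ cong (_+ b) (m+[n∸m]≡n e≤k) ⟩
      k + b             ≡⟨ m+[n∸m]≡n (≤-trans (m≤n+m d u) (<⇒≤ z<n)) ⟨
      d + e             ≡⟨ +-comm d e ⟩
      e + d             ∎)) ⟩
    u + d             ≡⟨ +-identityʳ (u + d) ⟨
    u + d + 0 * n     ∎)
    where
    e = n ∸ d
    shuffle : ∀ e b c → e + (b + c) ≡ e + c + b
    shuffle = solve-∀
  window-complete {u} {z} u<n z<n dist≤k | inj₂ (d , refl , dist≡) with ⊓-≤-cases (subst (_≤ k) dist≡ dist≤k)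
  ...   | inj₁ d<k = k ∸ suc d , 1 , ≤-trans (m∸n≤m k (suc d)) (m≤m+n k k) , (begin-equality
    z + suc d + b + (k ∸ suc d)   ≡⟨ shuffle z (suc d) b (k ∸ suc d) ⟩
    z + (suc d + (k ∸ suc d) + b) ≡⟨ cong (λ x → z + (x + b)) (m+[n∸m]≡n d<k) ⟩
    z + (k + b)                   ≡⟨ cong (z +_) (+-identityʳ (k + b)) ⟨
    z + 1 * n                     ∎)
    where
    shuffle : ∀ z d b c → z + d + b + c ≡ z + (d + c + b)
    shuffle = solve-∀
  ...   | inj₂ e≤k = k + e , 2 , +-monoʳ-≤ k e≤k , (begin-equality
    z + suc d + b + (k + e)   ≡⟨ shuffle z (suc d) b k e ⟩
    z + (suc d + e + (k + b)) ≡⟨ cong (λ x → z + (x + (k + b))) (m+[n∸m]≡n (≤-trans (m≤n+m (suc d) z) (<⇒≤ u<n))) ⟩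
    z + (k + b + (k + b))     ≡⟨ cong (λ x → z + (k + b + x)) (+-identityʳ (k + b)) ⟨
    z + 2 * n                 ∎)
    where
    e = n ∸ suc d
    shuffle : ∀ z d b k e → z + d + b + (k + e) ≡ z + (d + e + (k + b))
    shuffle = solve-∀

module _ {n k : ℕ} .{{_ : NonZero n}} (2k<n : suc (k + k) ≤ n) where

  open ≤-Reasoning

  private
    b = n ∸ k

    k<b : k < b
    k<b = m+n≤o⇒m≤o∸n (suc k) 2k<n

    k+b≡n : k + b ≡ n
    k+b≡n = m+[n∸m]≡n (≤-trans (m≤m+n k k) (<⇒≤ 2k<n))

  -- N[u] is the cyclic window of 2k + 1 vertices starting at u + n - k.
  window⇒dist≤ : ∀ {u z t} → u < n → t ≤ k + k → (u + (n ∸ k) + t) % n ≡ z → dist n u z ≤ k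
  window⇒dist≤ {u} {z} {t} u<n t≤2k eq =
    subst (λ N → dist N u z ≤ k) k+b≡n (window-sound k<b (x / n) t≤2k x/n<3 x≡z+qn)
    where
    x = u + b + t
    x<3n : x < 3 * n
    x<3n = begin-strict
      u + b + t     <⟨ +-monoˡ-< t (+-monoˡ-< b u<n) ⟩
      n + b + t     ≤⟨ +-monoʳ-≤ (n + b) (≤-trans t≤2k (<⇒≤ 2k<n)) ⟩
      n + b + n     ≤⟨ +-monoˡ-≤ n (+-monoʳ-≤ n (m∸n≤m n k)) ⟩
      n + n + n     ≡⟨ triple n ⟩
      3 * n         ∎
      where
      triple : ∀ n → n + n + n ≡ 3 * n
      triple = solve-∀
    x/n<3 : x / n < 3
    x/n<3 = m<n*o⇒m/o<n x<3n
    x≡z+qn : x ≡ z + (x / n) * (k + b)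
    x≡z+qn = begin-equality
      x                     ≡⟨ m≡m%n+[m/n]*n x n ⟩
      x % n + (x / n) * n   ≡⟨ cong₂ (λ r N → r + (x / n) * N) eq (sym k+b≡n) ⟩
      z + (x / n) * (k + b) ∎

  dist≤⇒window : ∀ {u z} → u < n → z < n → dist n u z ≤ k → ∃ λ t → t ≤ k + k × (u + (n ∸ k) + t) % n ≡ z
  dist≤⇒window {u} {z} u<n z<n dist≤k with window-complete k<b (≤-trans u<n (≤-reflexive (sym k+b≡n)))
                                                              (≤-trans z<n (≤-reflexive (sym k+b≡n)))
                                                              (subst (λ N → dist N u z ≤ k) (sym k+b≡n) dist≤k)
  ... | t , q , t≤2k , eq = t , t≤2k , (begin-equality
    (u + b + t) % n     ≡⟨ cong (_% n) eq ⟩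
    (z + q * (k + b)) % n ≡⟨ cong (λ N → (z + q * N) % n) k+b≡n ⟩
    (z + q * n) % n     ≡⟨ [m+kn]%n≡m%n z q n ⟩
    z % n               ≡⟨ m<n⇒m%n≡m z<n ⟩
    z                   ∎)

-- Runs of zeros

module Runs (v : ℕ) where

  open ≡-Reasoning

  w : ℕ
  w = suc v

  -- Whether a maximal run of c zeros may occur in the indicator word of a convex set.
  admissible : ℕ → Bool
  admissible zero    = true
  admissible (suc c) = does (w ≤? suc c)

  admissible-≥ : ∀ {c} → w ≤ c → admissible c ≡ true
  admissible-≥ {suc c} w≤c = dec-true (w ≤? suc c) w≤c

  admissible-< : ∀ {c} → suc c < w → admissible (suc c) ≡ false
  admissible-< {c} c<w = dec-false (w ≤? suc c) (<⇒≱ c<w)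

  admissible⇒ : ∀ c → admissible c ≡ true → c ≡ 0 ⊎ w ≤ c
  admissible⇒ zero    _  = inj₁ refl
  admissible⇒ (suc c) ok with w ≤? suc c
  ... | yes w≤c = inj₂ w≤c
  ... | no  w≰c = contradiction (trans (sym ok) (admissible-< (≰⇒> w≰c))) λ ()

  admissible⇐ : ∀ {c} → c ≡ 0 ⊎ w ≤ c → admissible c ≡ true
  admissible⇐ (inj₁ refl) = refl
  admissible⇐ (inj₂ w≤c)  = admissible-≥ w≤c

  -- closed m c counts the words of length m which, read after c zeros, close only admissible runs
  -- and end with a one (or are empty, when c = 0).
  closed : ℕ → ℕ → ℕ
  closed zero    zero    = 1
  closed zero    (suc c) = 0
  closed (suc m) c       = closed m (suc c) + (if admissible c then closed m 0 else 0)

  closed-saturated : ∀ m {c} → w ≤ c → closed m c ≡ closed m w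
  closed-saturated zero    {suc c} _   = refl
  closed-saturated (suc m) {c}     w≤c
    rewrite closed-saturated m {suc c} (m≤n⇒m≤1+n w≤c) | closed-saturated m {suc w} (n≤1+n w)
          | admissible-≥ w≤c | admissible-≥ {w} ≤-refl = refl

  closed-w-suc : ∀ m → closed (suc m) w ≡ closed m w + closed m 0
  closed-w-suc m rewrite closed-saturated m {suc w} (n≤1+n w) | admissible-≥ {w} ≤-refl = refl

  closed-mid : ∀ m {c} → 1 ≤ c → c ≤ w → closed m c ≡ closed (m ∸ (w ∸ c)) w
  closed-mid zero    {suc c} _ _ rewrite 0∸n≡0 (w ∸ suc c) = refl
  closed-mid (suc m) {suc c} _ c≤w with m≤n⇒m<n∨m≡n c≤w
  ... | inj₂ refl rewrite n∸n≡0 v = refl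
  ... | inj₁ c<w rewrite admissible-< c<w | +-identityʳ (closed m (suc (suc c)))
                       | closed-mid m (s≤s z≤n) c<w | +-∸-assoc 1 (s≤s⁻¹ c<w) = refl

  closed-0-suc : ∀ m → closed (suc m) 0 ≡ closed m 0 + closed (suc m ∸ w) w
  closed-0-suc m rewrite closed-mid m (s≤s z≤n) (s≤s z≤n) = +-comm _ (closed m 0)

  closed-0-short : ∀ {m} → m ≤ w → closed m 0 ≡ 1
  closed-0-short {zero}  _   = refl
  closed-0-short {suc m} m<w
    rewrite closed-0-suc m | closed-0-short (m≤n⇒m≤1+n (s≤s⁻¹ m<w)) | m≤n⇒m∸n≡0 m<w = refl

  closed-w-short : ∀ {m} → m ≤ suc w → closed m w ≡ m
  closed-w-short {zero}  _   = refl
  closed-w-short {suc m} m≤w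
    rewrite closed-w-suc m | closed-w-short (m≤n⇒m≤1+n (s≤s⁻¹ m≤w))
          | closed-0-short (s≤s⁻¹ m≤w) = +-comm m 1

  closedPast : ℕ → ℕ
  closedPast x with w ≤? x
  ... | yes _ = closed (x ∸ w) 0
  ... | no  _ = 0

  closedPast-≥ : ∀ {x} → w ≤ x → closedPast x ≡ closed (x ∸ w) 0
  closedPast-≥ {x} w≤x with w ≤? x
  ... | yes _   = refl
  ... | no  w≰x = contradiction w≤x w≰x

  closedPast-+w : ∀ x → closedPast (x + w) ≡ closed x 0
  closedPast-+w x rewrite closedPast-≥ (m≤n+m w x) | m+n∸n≡m x w = refl

  closed-w-suc∸w : ∀ x → closed (suc x ∸ w) w ≡ closed (x ∸ w) w + closedPast x
  closed-w-suc∸w x with w ≤? x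
  ... | yes w≤x rewrite +-∸-assoc 1 w≤x = closed-w-suc (x ∸ w)
  ... | no  w≰x rewrite m≤n⇒m∸n≡0 (≰⇒> w≰x) | m≤n⇒m∸n≡0 (<⇒≤ (≰⇒> w≰x)) = refl

  -- linear and cyclic count the words accepted by runsOK and cyclicRunsOK (see count-runsOK).
  linear : ℕ → ℕ → ℕ → ℕ
  linear zero    c t = if admissible (t + c) then 1 else 0
  linear (suc m) c t = linear m (suc c) t + (if admissible c then linear m 0 t else 0)

  linear-saturatedˡ : ∀ m {c} t → w ≤ c → linear m c t ≡ linear m w t
  linear-saturatedˡ zero    {c} t w≤c
    rewrite admissible-≥ (≤-trans w≤c (m≤n+m c t)) | admissible-≥ (m≤n+m w t) = refl
  linear-saturatedˡ (suc m) {c} t w≤c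
    rewrite linear-saturatedˡ m {suc c} t (m≤n⇒m≤1+n w≤c) | linear-saturatedˡ m {suc w} t (n≤1+n w)
          | admissible-≥ w≤c | admissible-≥ {w} ≤-refl = refl

  linear-saturatedʳ : ∀ m c {t} → w ≤ t → linear m c t ≡ linear m c w
  linear-saturatedʳ zero    c {t} w≤t
    rewrite admissible-≥ (≤-trans w≤t (m≤m+n t c)) | admissible-≥ (m≤m+n w c) = refl
  linear-saturatedʳ (suc m) c     w≤t
    rewrite linear-saturatedʳ m (suc c) w≤t | linear-saturatedʳ m 0 w≤t = refl

  linear-untailed : ∀ m c → linear m c 0 ≡ closed (suc m) c
  linear-untailed zero    c = refl
  linear-untailed (suc m) c rewrite linear-untailed m (suc c) | linear-untailed m 0 = refl

  linear-tailed-0   : ∀ m {t} → 1 ≤ t → t ≤ w → linear m 0 t ≡ closed (suc m + t ∸ w) w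
  linear-tailed-suc : ∀ m {c t} → 1 ≤ t → t ≤ w → suc c ≤ w → linear m (suc c) t ≡ closedPast (m + suc c + t)

  linear-tailed-0 zero {suc t} _ t≤w rewrite +-identityʳ t with m≤n⇒m<n∨m≡n t≤w
  ... | inj₂ refl rewrite admissible-≥ {w} ≤-refl | m+n∸n≡m 1 w | closed-w-suc 0 = refl
  ... | inj₁ t<w  rewrite admissible-< t<w | m≤n⇒m∸n≡0 t<w = refl
  linear-tailed-0 (suc m) {t} 1≤t t≤w = begin
    linear m 1 t + linear m 0 t
      ≡⟨ cong₂ _+_ (linear-tailed-suc m 1≤t t≤w (s≤s z≤n)) (linear-tailed-0 m 1≤t t≤w) ⟩
    closedPast (m + 1 + t) + closed (suc m + t ∸ w) w
      ≡⟨ cong (λ x → closedPast (x + t) + closed (suc m + t ∸ w) w) (+-comm m 1) ⟩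
    closedPast (suc m + t) + closed (suc m + t ∸ w) w
      ≡⟨ +-comm (closedPast (suc m + t)) (closed (suc m + t ∸ w) w) ⟩
    closed (suc m + t ∸ w) w + closedPast (suc m + t)
      ≡⟨ closed-w-suc∸w (suc m + t) ⟨
    closed (suc (suc m) + t ∸ w) w ∎

  linear-tailed-suc zero {c} {t} _ t≤w c<w rewrite +-comm t (suc c) with w ≤? suc (c + t)
  ... | yes w≤x rewrite admissible-≥ w≤x =
    sym (closed-0-short (m≤n+o⇒m∸n≤o (suc c + t) w (+-mono-≤ c<w t≤w)))
  ... | no  w≰x rewrite admissible-< (≰⇒> w≰x) = refl
  linear-tailed-suc (suc m) {c} {t} 1≤t t≤w c<w with m≤n⇒m<n∨m≡n c<w
  ... | inj₁ c<w′ rewrite admissible-< c<w′ | +-identityʳ (linear m (suc (suc c)) t)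
                        | linear-tailed-suc m 1≤t t≤w c<w′ | +-suc m (suc c) = refl
  ... | inj₂ refl = begin
    linear m (suc w) t + (if admissible w then linear m 0 t else 0)
      ≡⟨ cong₂ _+_ (linear-saturatedˡ m t (n≤1+n w))
                   (cong (λ b → if b then linear m 0 t else 0) (admissible-≥ {w} ≤-refl)) ⟩
    linear m w t + linear m 0 t
      ≡⟨ cong₂ _+_ (linear-tailed-suc m 1≤t t≤w ≤-refl) (linear-tailed-0 m 1≤t t≤w) ⟩
    closedPast (m + w + t) + closed (suc m + t ∸ w) w
      ≡⟨ cong (λ x → closedPast x + closed (suc m + t ∸ w) w) (+-right-comm m w t) ⟩
    closedPast (m + t + w) + closed (suc m + t ∸ w) w
      ≡⟨ cong (_+ closed (suc m + t ∸ w) w) (closedPast-+w (m + t)) ⟩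
    closed (m + t) 0 + closed (suc (m + t) ∸ w) w
      ≡⟨ closed-0-suc (m + t) ⟨
    closed (suc m + t) 0
      ≡⟨ closedPast-+w (suc m + t) ⟨
    closedPast (suc m + t + w)
      ≡⟨ cong closedPast (+-right-comm (suc m) w t) ⟨
    closedPast (suc m + w + t) ∎

  cyclic : ℕ → ℕ → ℕ
  cyclic zero    a = 1
  cyclic (suc m) a = cyclic m (suc a) + linear m 0 a

  cyclic-saturated : ∀ m {a} → w ≤ a → cyclic m a ≡ cyclic m w
  cyclic-saturated zero    _   = refl
  cyclic-saturated (suc m) {a} w≤a
    rewrite cyclic-saturated m {suc a} (m≤n⇒m≤1+n w≤a) | cyclic-saturated m {suc w} (n≤1+n w)
          | linear-saturatedʳ m 0 w≤a = refl

  cyclic-closedForm : ∀ m {a} → 1 ≤ a → a ≤ w →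
                      cyclic m a ≡ closed (m + a) 0 + (w ∸ a) * closed (m + a ∸ w) w
  cyclic-closedForm zero {a} _ a≤w
    rewrite m≤n⇒m∸n≡0 a≤w | *-zeroʳ (w ∸ a) | closed-0-short a≤w = refl
  cyclic-closedForm (suc m) {a} 1≤a a≤w with m≤n⇒m<n∨m≡n a≤w
  ... | inj₁ a<w = begin
    cyclic m (suc a) + linear m 0 a
      ≡⟨ cong₂ _+_ (cyclic-closedForm m (s≤s z≤n) a<w) (linear-tailed-0 m 1≤a a≤w) ⟩
    closed (m + suc a) 0 + (w ∸ suc a) * closed (m + suc a ∸ w) w + y
      ≡⟨ cong (λ n → closed n 0 + (w ∸ suc a) * closed (n ∸ w) w + y) (+-suc m a) ⟩
    x + (w ∸ suc a) * y + y
      ≡⟨ +-assoc x _ y ⟩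
    x + ((w ∸ suc a) * y + y)
      ≡⟨ cong (x +_) (+-comm _ y) ⟩
    x + suc (w ∸ suc a) * y
      ≡⟨ cong (λ d → x + d * y) (+-∸-assoc 1 a<w) ⟨
    x + (w ∸ a) * y ∎
    where
    x = closed (suc m + a) 0
    y = closed (suc m + a ∸ w) w
  ... | inj₂ refl = begin
    cyclic m (suc w) + linear m 0 w
      ≡⟨ cong (_+ linear m 0 w) (cyclic-saturated m (n≤1+n w)) ⟩
    cyclic m w + linear m 0 w
      ≡⟨ cong₂ _+_ (cyclic-closedForm m (s≤s z≤n) ≤-refl) (linear-tailed-0 m (s≤s z≤n) ≤-refl) ⟩
    closed (m + w) 0 + (w ∸ w) * closed (m + w ∸ w) w + closed (suc m + w ∸ w) w
      ≡⟨ cong (λ d → closed (m + w) 0 + d * closed (m + w ∸ w) w + closed (suc m + w ∸ w) w) (n∸n≡0 w) ⟩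
    closed (m + w) 0 + 0 + closed (suc (m + w) ∸ w) w
      ≡⟨ cong (_+ closed (suc (m + w) ∸ w) w) (+-identityʳ (closed (m + w) 0)) ⟩
    closed (m + w) 0 + closed (suc (m + w) ∸ w) w
      ≡⟨ closed-0-suc (m + w) ⟨
    closed (suc m + w) 0
      ≡⟨ +-identityʳ _ ⟨
    closed (suc m + w) 0 + 0 * closed (suc m + w ∸ w) w
      ≡⟨ cong (λ d → closed (suc m + w) 0 + d * closed (suc m + w ∸ w) w) (n∸n≡0 w) ⟨
    closed (suc m + w) 0 + (w ∸ w) * closed (suc m + w ∸ w) w ∎

  cyclicCount : ℕ → ℕ
  cyclicCount n = 2 * closed n 0 + v * closed (n ∸ w) w

  cyclic-0 : ∀ m → cyclic (suc m) 0 ≡ cyclicCount (suc m)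
  cyclic-0 m = begin
    cyclic m 1 + linear m 0 0
      ≡⟨ cong₂ _+_ (cyclic-closedForm m (s≤s z≤n) (s≤s z≤n)) (linear-untailed m 0) ⟩
    closed (m + 1) 0 + v * closed (m + 1 ∸ w) w + closed (suc m) 0
      ≡⟨ cong (λ x → closed x 0 + v * closed (x ∸ w) w + closed (suc m) 0) (+-comm m 1) ⟩
    closed (suc m) 0 + v * closed (suc m ∸ w) w + closed (suc m) 0
      ≡⟨ rearrange (closed (suc m) 0) (v * closed (suc m ∸ w) w) ⟩
    cyclicCount (suc m) ∎
    where
    rearrange : ∀ x y → x + y + x ≡ 2 * x + y
    rearrange = solve-∀

  closed-0-suc+w : ∀ q → closed (suc q + w) 0 ≡ closed (q + w) 0 + closed (suc q) w
  closed-0-suc+w q = trans (closed-0-suc (q + w)) (cong (λ x → closed (q + w) 0 + closed x w) (m+n∸n≡m (suc q) w))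

  closed-0-rec : ∀ q → closed (2 + q + w) 0 + closed (q + w) 0 ≡ 2 * closed (1 + q + w) 0 + closed (1 + q) 0
  closed-0-rec q rewrite closed-0-suc+w (suc q) | closed-w-suc (suc q) | closed-0-suc+w q =
    rearrange (closed (q + w) 0) (closed (suc q) w) (closed (suc q) 0)
    where
    rearrange : ∀ a b c → a + b + (b + c) + a ≡ 2 * (a + b) + c
    rearrange = solve-∀

  closed-w-rec : ∀ m → closed (2 + m) w + closed m w ≡ 2 * closed (1 + m) w + closed (1 + m ∸ w) w
  closed-w-rec m rewrite closed-w-suc (suc m) | closed-0-suc m | closed-w-suc m =
    rearrange (closed m w) (closed m 0) (closed (suc m ∸ w) w)
    where
    rearrange : ∀ a b c → a + b + (b + c) + a ≡ 2 * (a + b) + c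
    rearrange = solve-∀

  cyclicCount-rec : ∀ q → cyclicCount (2 + q + w) + cyclicCount (q + w) ≡ 2 * cyclicCount (1 + q + w) + cyclicCount (1 + q)
  cyclicCount-rec q rewrite m+n∸n≡m (2 + q) w | m+n∸n≡m q w | m+n∸n≡m (1 + q) w = begin
    (2 * E₂ + v * S₂) + (2 * E₀ + v * S₀)  ≡⟨ collect v E₂ E₀ S₂ S₀ ⟩
    2 * (E₂ + E₀) + v * (S₂ + S₀)          ≡⟨ cong₂ (λ x y → 2 * x + v * y) (closed-0-rec q) (closed-w-rec q) ⟩
    2 * (2 * E₁ + E) + v * (2 * S₁ + S)    ≡⟨ distribute v E₁ E S₁ S ⟩
    2 * (2 * E₁ + v * S₁) + (2 * E + v * S) ∎
    where
    E₀ = closed (q + w) 0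
    E₁ = closed (1 + q + w) 0
    E₂ = closed (2 + q + w) 0
    E  = closed (1 + q) 0
    S₀ = closed q w
    S₁ = closed (1 + q) w
    S₂ = closed (2 + q) w
    S  = closed (1 + q ∸ w) w
    collect : ∀ v a b a′ b′ → (2 * a + v * a′) + (2 * b + v * b′) ≡ 2 * (a + b) + v * (a′ + b′)
    collect = solve-∀
    distribute : ∀ v c d c′ d′ → 2 * (2 * c + d) + v * (2 * c′ + d′) ≡ 2 * (2 * c + v * c′) + (2 * d + v * d′)
    distribute = solve-∀

  cyclicCount-short : ∀ {n} → n ≤ w → cyclicCount n ≡ 2
  cyclicCount-short n≤w rewrite m≤n⇒m∸n≡0 n≤w | closed-0-short n≤w | *-zeroʳ v = refl

  closed-0-above : ∀ {i} → i ≤ suc w → 2 * closed (i + w) 0 ≡ 2 + i * suc i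
  closed-0-above {zero}  _ rewrite closed-0-short {w} ≤-refl = refl
  closed-0-above {suc i} i≤w = begin
    2 * closed (suc i + w) 0                  ≡⟨ cong (2 *_) (closed-0-suc+w i) ⟩
    2 * (closed (i + w) 0 + closed (suc i) w) ≡⟨ cong (λ x → 2 * (closed (i + w) 0 + x)) (closed-w-short i≤w) ⟩
    2 * (closed (i + w) 0 + suc i)            ≡⟨ *-distribˡ-+ 2 (closed (i + w) 0) (suc i) ⟩
    2 * closed (i + w) 0 + 2 * suc i          ≡⟨ cong (_+ 2 * suc i) (closed-0-above (m≤n⇒m≤1+n (s≤s⁻¹ i≤w))) ⟩
    2 + i * suc i + 2 * suc i                 ≡⟨ step i ⟩
    2 + suc i * suc (suc i)                   ∎
    where
    step : ∀ i → 2 + i * suc i + 2 * suc i ≡ 2 + suc i * suc (suc i)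
    step = solve-∀

  cyclicCount-middle : ∀ {j} → w ≤ j → j ∸ w ≤ suc w → cyclicCount j ≡ 2 + j * (j ∸ w)
  cyclicCount-middle {j} w≤j i≤w = begin
    cyclicCount j                         ≡⟨ cong cyclicCount j≡i+w ⟩
    2 * closed (i + w) 0 + v * closed (i + w ∸ w) w
      ≡⟨ cong₂ (λ x y → x + v * closed y w) (closed-0-above i≤w) (m+n∸n≡m i w) ⟩
    2 + i * suc i + v * closed i w        ≡⟨ cong (λ x → 2 + i * suc i + v * x) (closed-w-short i≤w) ⟩
    2 + i * suc i + v * i                 ≡⟨ collect v i ⟩
    2 + (i + w) * i                       ≡⟨ cong (λ x → 2 + x * i) j≡i+w ⟨
    2 + j * i                             ∎
    where
    i = j ∸ w
    j≡i+w : j ≡ i + w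
    j≡i+w = sym (m∸n+n≡m w≤j)
    collect : ∀ v i → 2 + i * suc i + v * i ≡ 2 + (i + suc v) * i
    collect = solve-∀

  -- runsOK c t l: all maximal runs of zeros in 0ᶜ l 0ᵗ are admissible. cyclicRunsOK a l does the same for
  -- the cyclic word 0ᵃ l, whose leading zeros continue its last run.
  runsOK : ℕ → ℕ → List Bool → Bool
  runsOK c t []          = admissible (t + c)
  runsOK c t (false ∷ l) = runsOK (suc c) t l
  runsOK c t (true  ∷ l) = admissible c ∧ runsOK 0 t l

  cyclicRunsOK : ℕ → List Bool → Bool
  cyclicRunsOK a []          = true
  cyclicRunsOK a (false ∷ l) = cyclicRunsOK (suc a) l
  cyclicRunsOK a (true  ∷ l) = runsOK 0 a l

  count-runsOK : ∀ m c t → count m (runsOK c t ∘ toList) ≡ linear m c t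
  count-runsOK zero    c t = refl
  count-runsOK (suc m) c t =
    cong₂ _+_ (count-runsOK m (suc c) t)
              (trans (count-∧ m (admissible c) (runsOK 0 t ∘ toList))
                     (cong (λ x → if admissible c then x else 0) (count-runsOK m 0 t)))

  count-cyclicRunsOK : ∀ m a → count m (cyclicRunsOK a ∘ toList) ≡ cyclic m a
  count-cyclicRunsOK zero    a = refl
  count-cyclicRunsOK (suc m) a = cong₂ _+_ (count-cyclicRunsOK m (suc a)) (count-runsOK m 0 a)

  runsOK-zeros : ∀ c t → runsOK c 0 (replicate t false) ≡ admissible (t + c)
  runsOK-zeros c zero    = refl
  runsOK-zeros c (suc t) = trans (runsOK-zeros (suc c) t) (cong admissible (+-suc t c))

  runsOK-tail : ∀ c t l → runsOK c t l ≡ runsOK c 0 (l ++ replicate t false)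
  runsOK-tail c t []          = sym (runsOK-zeros c t)
  runsOK-tail c t (false ∷ l) = runsOK-tail (suc c) t l
  runsOK-tail c t (true  ∷ l) = cong (admissible c ∧_) (runsOK-tail 0 t l)

  ZeroRun : (ℕ → Bool) → ℕ → Set
  ZeroRun g j = ∀ t → t < w → g (j + t) ≡ false

  Covered : (ℕ → Bool) → ℕ → Set
  Covered g L = ∀ i → i < L → g i ≡ false → ∃ λ j → j ≤ i × i < j + w × j + w ≤ L × ZeroRun g j

  zeroRun-before : ∀ {g j p} → g p ≡ true → ZeroRun g j → j ≤ p → j + w ≤ p
  zeroRun-before {g} {j} {p} gp≡true zeros j≤p with j + w ≤? p
  ... | yes j+w≤p = j+w≤p
  ... | no  j+w≰p = contradiction (trans (sym gp≡true) gp≡false) λ ()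
    where
    gp≡false : g p ≡ false
    gp≡false = trans (cong g (sym (m+[n∸m]≡n j≤p))) (zeros (p ∸ j) (m<n+o⇒m∸n<o p j (≰⇒> j+w≰p)))

  Covered-cong : ∀ {g h L} → (∀ i → i < L → g i ≡ h i) → Covered g L → Covered h L
  Covered-cong g≗h cov i i<L hi≡false with cov i i<L (trans (g≗h i i<L) hi≡false)
  ... | j , j≤i , i<j+w , j+w≤L , zeros =
    j , j≤i , i<j+w , j+w≤L , λ t t<w → trans (sym (g≗h (j + t) (≤-trans (+-monoʳ-< j t<w) j+w≤L))) (zeros t t<w)

  Covered-zeros⇒ : ∀ {g c} → (∀ i → i < c → g i ≡ false) → Covered g c → c ≡ 0 ⊎ w ≤ c
  Covered-zeros⇒ {c = zero}  _     _   = inj₁ refl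
  Covered-zeros⇒ {c = suc c} zeros cov with cov 0 (s≤s z≤n) (zeros 0 (s≤s z≤n))
  ... | zero , _ , _ , w≤c , _ = inj₂ w≤c

  Covered-zeros⇐ : ∀ {g c} → (∀ i → i < c → g i ≡ false) → w ≤ c → Covered g c
  Covered-zeros⇐ {g} {c} zeros w≤c i i<c _ with i + w ≤? c
  ... | yes i+w≤c = i , ≤-refl , m<m+n i (s≤s z≤n) , i+w≤c , λ t t<w → zeros (i + t) (≤-trans (+-monoʳ-< i t<w) i+w≤c)
  ... | no  i+w≰c = c ∸ w , c∸w≤i , subst (i <_) (sym end≡c) i<c , ≤-reflexive end≡c ,
                    λ t t<w → zeros (c ∸ w + t) (≤-trans (+-monoʳ-< (c ∸ w) t<w) (≤-reflexive end≡c))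
    where
    end≡c : c ∸ w + w ≡ c
    end≡c = m∸n+n≡m w≤c
    c∸w≤i : c ∸ w ≤ i
    c∸w≤i = m≤n+o⇒m∸n≤o c w (subst (c ≤_) (+-comm i w) (<⇒≤ (≰⇒> i+w≰c)))

  module _ {g : ℕ → Bool} {p : ℕ} (gp≡true : g p ≡ true) where

    private
      g⁺ : ℕ → Bool
      g⁺ i = g (suc (p + i))

      shift : ∀ j t → suc (p + (j + t)) ≡ suc (p + j) + t
      shift j t = cong suc (sym (+-assoc p j t))

    Covered-left : ∀ {q} → Covered g (p + suc q) → Covered g p
    Covered-left {q} cov i i<p gi≡false with cov i (≤-trans i<p (m≤m+n p (suc q))) gi≡false
    ... | j , j≤i , i<j+w , _ , zeros = j , j≤i , i<j+w , zeroRun-before {g} gp≡true zeros (≤-trans j≤i (<⇒≤ i<p)) , zeros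

    Covered-right : ∀ {q} → Covered g (p + suc q) → Covered g⁺ q
    Covered-right {q} cov i i<q gi≡false
      with cov (suc (p + i)) (subst (suc (p + i) <_) (sym (+-suc p q)) (s≤s (+-monoʳ-< p i<q))) gi≡false
    ... | j , j≤i , i<j+w , j+w≤L , zeros =
      j′ , j′≤i , i<j′+w , j′+w≤q , λ t t<w → trans (cong g (trans (shift j′ t) (cong (_+ t) j≡))) (zeros t t<w)
      where
      p<j : suc p ≤ j
      p<j with suc p ≤? j
      ... | yes p<j = p<j
      ... | no  p≮j = contradiction (zeroRun-before {g} gp≡true zeros (s≤s⁻¹ (≰⇒> p≮j)))
                        (<⇒≱ (≤-trans (s≤s (m≤m+n p i)) (<⇒≤ i<j+w)))
      j′ = j ∸ suc p
      j≡ : suc (p + j′) ≡ j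
      j≡ = m+[n∸m]≡n p<j
      j′≤i : j′ ≤ i
      j′≤i = +-cancelˡ-≤ (suc p) j′ i (subst (_≤ suc (p + i)) (sym j≡) j≤i)
      j+w≡ : j + w ≡ suc p + (j′ + w)
      j+w≡ = trans (cong (_+ w) (sym j≡)) (+-assoc (suc p) j′ w)
      i<j′+w : i < j′ + w
      i<j′+w = +-cancelˡ-< (suc p) i (j′ + w) (subst (suc (p + i) <_) j+w≡ i<j+w)
      j′+w≤q : j′ + w ≤ q
      j′+w≤q = +-cancelˡ-≤ (suc p) (j′ + w) q (subst₂ _≤_ j+w≡ (+-suc p q) j+w≤L)

    Covered-join : ∀ {q} → Covered g p → Covered g⁺ q → Covered g (p + suc q)
    Covered-join {q} covˡ covʳ i i<L gi≡false with <-cmp i p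
    ... | tri< i<p _ _ with covˡ i i<p gi≡false
    ...   | j , j≤i , i<j+w , j+w≤p , zeros = j , j≤i , i<j+w , ≤-trans j+w≤p (m≤m+n p (suc q)) , zeros
    Covered-join {q} covˡ covʳ i i<L gi≡false | tri≈ _ refl _ = contradiction (trans (sym gp≡true) gi≡false) λ ()
    Covered-join {q} covˡ covʳ i i<L gi≡false | tri> _ _ p<i
      with covʳ (i ∸ suc p) (+-cancelˡ-< (suc p) (i ∸ suc p) q (subst₂ _<_ (sym (m+[n∸m]≡n p<i)) (+-suc p q) i<L))
                (trans (cong g (m+[n∸m]≡n p<i)) gi≡false)
    ... | j , j≤i′ , i′<j+w , j+w≤q , zeros =
      suc (p + j) , subst (suc (p + j) ≤_) (m+[n∸m]≡n p<i) (s≤s (+-monoʳ-≤ p j≤i′)) ,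
      subst₂ _<_ (m+[n∸m]≡n p<i) (cong suc (sym (+-assoc p j w))) (s≤s (+-monoʳ-< p i′<j+w)) ,
      subst₂ _≤_ (cong suc (sym (+-assoc p j w))) (sym (+-suc p q)) (s≤s (+-monoʳ-≤ p j+w≤q)) ,
      λ t t<w → trans (cong g (sym (shift j t))) (zeros t t<w)

  runsOK⇒Covered : ∀ c x → runsOK c 0 x ≡ true → Covered (letter (replicate c false ++ x)) (c + length x)
  runsOK⇒Covered c [] ok with admissible⇒ c ok
  ... | inj₁ refl = λ _ ()
  ... | inj₂ w≤c  = subst (Covered (letter (replicate c false ++ []))) (sym (+-identityʳ c))
                          (Covered-zeros⇐ (λ _ → letter-zeros++ c) w≤c)
  runsOK⇒Covered c (false ∷ x) ok =
    subst₂ Covered (cong letter (sym (zeros-∷ c x))) (sym (+-suc c (length x))) (runsOK⇒Covered (suc c) x ok)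
  runsOK⇒Covered c (true ∷ x) ok with ∧-≡-true {admissible c} ok
  ... | c-ok , x-ok =
    Covered-join (letter-one c x) left (Covered-cong (λ i _ → sym (letter-after-one c x i)) (runsOK⇒Covered 0 x x-ok))
    where
    left : Covered (letter (replicate c false ++ true ∷ x)) c
    left with admissible⇒ c c-ok
    ... | inj₁ refl = λ _ ()
    ... | inj₂ w≤c  = Covered-zeros⇐ (λ _ → letter-zeros++ c) w≤c

  Covered⇒runsOK : ∀ c x → Covered (letter (replicate c false ++ x)) (c + length x) → runsOK c 0 x ≡ true
  Covered⇒runsOK c [] cov =
    admissible⇐ (subst (λ L → L ≡ 0 ⊎ w ≤ L) (+-identityʳ c)
      (Covered-zeros⇒ (λ _ i<c → letter-zeros++ c (subst (_ <_) (+-identityʳ c) i<c)) cov))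
  Covered⇒runsOK c (false ∷ x) cov =
    Covered⇒runsOK (suc c) x (subst₂ Covered (cong letter (zeros-∷ c x)) (+-suc c (length x)) cov)
  Covered⇒runsOK c (true ∷ x) cov =
    cong₂ _∧_ (admissible⇐ (Covered-zeros⇒ (λ _ → letter-zeros++ c) (Covered-left (letter-one c x) cov)))
              (Covered⇒runsOK 0 x (Covered-cong (λ i _ → letter-after-one c x i) (Covered-right (letter-one c x) cov)))

  module _ {n : ℕ} .{{_ : NonZero n}} where

    CyclicallyCovered : (ℕ → Bool) → Set
    CyclicallyCovered f = ∀ y → f (y % n) ≡ false →
      ∃₂ λ J t₀ → t₀ < w × (J + t₀) % n ≡ y % n × ZeroRun (λ i → f (i % n)) J

    module _ {f g : ℕ → Bool} (r : ℕ) (rotation : ∀ i → f ((r + i) % n) ≡ g (i % n)) where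

      private
        c = n ∸ r % n

        shuffle : ∀ r a c → r + (a + c) ≡ a + (r + c)
        shuffle = solve-∀

        undo : ∀ a → (r + (a + c)) % n ≡ a % n
        undo a = trans (cong (_% n) (shuffle r a c)) (+-complement-% r a)

      CyclicallyCovered-rotate : CyclicallyCovered f → CyclicallyCovered g
      CyclicallyCovered-rotate cov y gy≡false with cov (r + y) (trans (rotation y) gy≡false)
      ... | J , t₀ , t₀<w , J+t₀≡ , zeros =
        J + c , t₀ , t₀<w , +-cancelˡ-% r (J + c + t₀) y (trans (back t₀) J+t₀≡) ,
        λ t t<w → trans (sym (rotation (J + c + t))) (trans (cong f (back t)) (zeros t t<w))
        where
        back : ∀ t → (r + (J + c + t)) % n ≡ (J + t) % n
        back t = trans (cong (λ x → (r + x) % n) (+-right-comm J c t)) (undo (J + t))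

      CyclicallyCovered-unrotate : CyclicallyCovered g → CyclicallyCovered f
      CyclicallyCovered-unrotate cov y fy≡false
        with cov (y + c) (trans (sym (rotation (y + c))) (trans (cong f (undo y)) fy≡false))
      ... | J , t₀ , t₀<w , J+t₀≡ , zeros =
        r + J , t₀ , t₀<w , trans (cong (_% n) (+-assoc r J t₀)) (trans (+-congˡ-% r J+t₀≡) (undo y)) ,
        λ t t<w → trans (cong (λ x → f (x % n)) (+-assoc r J t)) (trans (rotation (J + t)) (zeros t t<w))

  module _ {m : ℕ} {f : ℕ → Bool} (fm≡true : f m ≡ true) where

    private
      n = suc m

      %-below : ∀ {i} → i < n → i % n ≡ i
      %-below = m<n⇒m%n≡m

    Covered⇒CyclicallyCovered : Covered f m → CyclicallyCovered {n} f
    Covered⇒CyclicallyCovered cov y fy≡false with cov (y % n) y%n<m fy≡false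
      where
      y%n<m : y % n < m
      y%n<m with m≤n⇒m<n∨m≡n (s≤s⁻¹ (m%n<n y n))
      ... | inj₁ y%n<m = y%n<m
      ... | inj₂ y%n≡m = contradiction (trans (sym fm≡true) (trans (cong f (sym y%n≡m)) fy≡false)) λ ()
    ... | j , j≤i , i<j+w , j+w≤m , zeros =
      j , y % n ∸ j , m<n+o⇒m∸n<o (y % n) j i<j+w ,
      trans (cong (_% n) (m+[n∸m]≡n j≤i)) (m%n%n≡m%n y n) ,
      λ t t<w → trans (cong f (%-below (≤-trans (+-monoʳ-< j t<w) (≤-trans j+w≤m (n≤1+n m))))) (zeros t t<w)

    CyclicallyCovered⇒Covered : CyclicallyCovered {n} f → Covered f m
    CyclicallyCovered⇒Covered cov i i<m fi≡false with cov i (trans (cong f (%-below (m<n⇒m<1+n i<m))) fi≡false)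
    ... | J , t₀ , t₀<w , J+t₀≡ , zeros = j , j≤i , i<j+w , j+w≤m ,
          λ t t<w → trans (cong f (sym (%-below (j+t<n t<w)))) (zeros′ t t<w)
      where
      j = J % n
      reduce : ∀ t → (j + t) % n ≡ (J + t) % n
      reduce t = %-+ˡ J t
      zeros′ : ZeroRun (λ x → f (x % n)) j
      zeros′ t t<w = trans (cong f (reduce t)) (zeros t t<w)
      j+w≤m : j + w ≤ m
      j+w≤m = zeroRun-before {λ x → f (x % n)} (trans (cong f (%-below ≤-refl)) fm≡true) zeros′ (s≤s⁻¹ (m%n<n J n))
      j+t<n : ∀ {t} → t < w → j + t < n
      j+t<n t<w = ≤-trans (+-monoʳ-< j t<w) (≤-trans j+w≤m (n≤1+n m))
      j+t₀≡i : j + t₀ ≡ i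
      j+t₀≡i = trans (sym (%-below (j+t<n t₀<w))) (trans (reduce t₀) (trans J+t₀≡ (%-below (m<n⇒m<1+n i<m))))
      j≤i : j ≤ i
      j≤i = subst (j ≤_) j+t₀≡i (m≤m+n j t₀)
      i<j+w : i < j + w
      i<j+w = subst (_< j + w) j+t₀≡i (+-monoʳ-< j t₀<w)

-- Digital convexity in powers of cycles

module Convexity (k : ℕ) where

  open Runs (k + k)
  open ≡-Reasoning

  ConvexWord : ℕ → List Bool → Set
  ConvexWord n L = ∀ y → y < n → letter L y ≡ false →
                   ∃ λ u → u < n × dist n u y ≤ k × (∀ z → z < n → dist n u z ≤ k → letter L z ≡ false)

  module _ {m : ℕ} (2k<n : suc (k + k) ≤ suc m) where

    private
      n = suc m

    ConvexWord⇒CyclicallyCovered : ∀ L → ConvexWord n L → CyclicallyCovered {n} (letter L)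
    ConvexWord⇒CyclicallyCovered L convex y Ly≡false with convex (y % n) (m%n<n y n) Ly≡false
    ... | u , u<n , dist≤k , zeros with dist≤⇒window 2k<n u<n (m%n<n y n) dist≤k
    ...   | t₀ , t₀≤2k , u+t₀≡y = u + (n ∸ k) , t₀ , s≤s t₀≤2k , u+t₀≡y ,
            λ t t<w → zeros _ (m%n<n (u + (n ∸ k) + t) n) (window⇒dist≤ 2k<n u<n (s≤s⁻¹ t<w) refl)

    CyclicallyCovered⇒ConvexWord : ∀ L → CyclicallyCovered {n} (letter L) → ConvexWord n L
    CyclicallyCovered⇒ConvexWord L cov y y<n Ly≡false with cov y (trans (cong (letter L) (m<n⇒m%n≡m y<n)) Ly≡false)
    ... | J , t₀ , t₀<w , J+t₀≡y , zeros =
      u , u<n , window⇒dist≤ 2k<n u<n (s≤s⁻¹ t₀<w) (trans (recentre t₀) (trans J+t₀≡y (m<n⇒m%n≡m y<n))) ,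
      λ z z<n dist≤k → absent z (dist≤⇒window 2k<n u<n z<n dist≤k)
      where
      u = (J + k) % n
      u<n : u < n
      u<n = m%n<n (J + k) n
      k≤n : k ≤ n
      k≤n = ≤-trans (m≤m+n k k) (<⇒≤ 2k<n)
      shuffle : ∀ J k c t → J + k + (c + t) ≡ J + t + (k + c)
      shuffle = solve-∀
      recentre : ∀ t → (u + (n ∸ k) + t) % n ≡ (J + t) % n
      recentre t = begin
        (u + (n ∸ k) + t) % n             ≡⟨ cong (_% n) (+-assoc u (n ∸ k) t) ⟩
        (u + ((n ∸ k) + t)) % n           ≡⟨ %-+ˡ (J + k) ((n ∸ k) + t) ⟩
        (J + k + ((n ∸ k) + t)) % n       ≡⟨ cong (_% n) (shuffle J k (n ∸ k) t) ⟩
        (J + t + (k + (n ∸ k))) % n       ≡⟨ cong (λ x → (J + t + x) % n) (m+[n∸m]≡n k≤n) ⟩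
        (J + t + n) % n                   ≡⟨ [m+n]%n≡m%n (J + t) n ⟩
        (J + t) % n                       ∎
      absent : ∀ z → (∃ λ t → t ≤ k + k × (u + (n ∸ k) + t) % n ≡ z) → letter L z ≡ false
      absent z (t , t≤2k , u+t≡z) = trans (cong (letter L) (trans (sym u+t≡z) (recentre t))) (zeros t (s≤s t≤2k))

  module _ (a : ℕ) (R : List Bool) where

    private
      L = replicate a false ++ true ∷ R
      x = R ++ replicate a false
      m = length R + a
      n = suc m

      length-x : length x ≡ m
      length-x = trans (length-++ R) (cong (length R +_) (length-replicate a))

      rotation< : ∀ j → j < n → letter L ((suc a + j) % n) ≡ letter x j
      rotation< j j<n with j <? length R
      ... | yes j<R = begin
        letter L ((suc a + j) % n) ≡⟨ cong (letter L) (m<n⇒m%n≡m a+j<m) ⟩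
        letter L (suc (a + j))     ≡⟨ letter-after-one a R j ⟩
        letter R j                 ≡⟨ letter-++ˡ R j j<R ⟨
        letter x j                 ∎
        where
        a+j<m : suc a + j < n
        a+j<m = s≤s (subst (a + j <_) (+-comm a (length R)) (+-monoʳ-< a j<R))
      ... | no  j≮R = begin
        letter L ((suc a + j) % n)   ≡⟨ cong (λ i → letter L ((suc a + i) % n)) (sym R+d≡j) ⟩
        letter L ((suc a + (length R + d)) % n) ≡⟨ cong (λ i → letter L (i % n)) (shuffle a (length R) d) ⟩
        letter L ((d + n) % n)       ≡⟨ cong (letter L) (trans ([m+n]%n≡m%n d n) (m<n⇒m%n≡m d<n)) ⟩
        letter L d                   ≡⟨ wrapped (m≤n⇒m<n∨m≡n d≤a) ⟩
        letter (replicate a false) d ≡⟨ letter-++ʳ R d ⟨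
        letter x (length R + d)      ≡⟨ cong (letter x) R+d≡j ⟩
        letter x j                   ∎
        where
        R≤j : length R ≤ j
        R≤j = ≮⇒≥ j≮R
        d = j ∸ length R
        R+d≡j : length R + d ≡ j
        R+d≡j = m+[n∸m]≡n R≤j
        d≤a : d ≤ a
        d≤a = +-cancelˡ-≤ (length R) d a (subst (_≤ length R + a) (sym R+d≡j) (s≤s⁻¹ j<n))
        d<n : d < n
        d<n = s≤s (≤-trans d≤a (m≤n+m a (length R)))
        shuffle : ∀ a r d → suc a + (r + d) ≡ d + suc (r + a)
        shuffle = solve-∀
        wrapped : d < a ⊎ d ≡ a → letter L d ≡ letter (replicate a false) d
        wrapped (inj₁ d<a)  = trans (letter-zeros++ a d<a) (sym (letter-zeros a d<a))
        wrapped (inj₂ refl) = trans (letter-one d R) (sym (letter-beyond (replicate d false) (≤-reflexive (length-replicate d))))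

      -- Rotating L left by a + 1 moves its first one to the end: the result is x followed by that one.
      rotation : ∀ i → letter L ((suc a + i) % n) ≡ letter x (i % n)
      rotation i = trans (cong (letter L) (sym (%-+ʳ {n} (suc a) i))) (rotation< (i % n) (m%n<n i n))

      x-ends-with-one : letter x m ≡ true
      x-ends-with-one = letter-beyond x (≤-reflexive length-x)

    ConvexWord-zeros-one⇔runsOK : suc (k + k) ≤ n → ConvexWord n L ⇔ (runsOK 0 a R ≡ true)
    ConvexWord-zeros-one⇔runsOK 2k<n = mk⇔
      (λ convex → trans (runsOK-tail 0 a R) (Covered⇒runsOK 0 x (subst (Covered (letter x)) (sym length-x)
         (CyclicallyCovered⇒Covered {m} {letter x} x-ends-with-one
           (CyclicallyCovered-rotate {n} {letter L} {letter x} (suc a) rotation (ConvexWord⇒CyclicallyCovered 2k<n L convex))))))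
      (λ ok → CyclicallyCovered⇒ConvexWord 2k<n L (CyclicallyCovered-unrotate {n} {letter L} {letter x} (suc a) rotation
         (Covered⇒CyclicallyCovered {m} {letter x} x-ends-with-one (subst (Covered (letter x)) length-x
           (runsOK⇒Covered 0 x (trans (sym (runsOK-tail 0 a R)) ok))))))

  cyclicRunsOK-zeros : ∀ c a → cyclicRunsOK c (replicate a false) ≡ true
  cyclicRunsOK-zeros c zero    = refl
  cyclicRunsOK-zeros c (suc a) = cyclicRunsOK-zeros (suc c) a

  cyclicRunsOK-zeros-one : ∀ c a R → cyclicRunsOK c (replicate a false ++ true ∷ R) ≡ runsOK 0 (a + c) R
  cyclicRunsOK-zeros-one c zero    R = refl
  cyclicRunsOK-zeros-one c (suc a) R = trans (cyclicRunsOK-zeros-one (suc c) a R) (cong (λ t → runsOK 0 t R) (+-suc a c))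

  ConvexWord-zeros : ∀ c → ConvexWord c (replicate c false)
  ConvexWord-zeros c y y<c _ = y , y<c , subst (_≤ k) (sym (dist-self c y)) z≤n , λ z z<c _ → letter-zeros c z<c

  zeros-or-one : ∀ (L : List Bool) → L ≡ replicate (length L) false ⊎ ∃₂ λ a R → L ≡ replicate a false ++ true ∷ R
  zeros-or-one []          = inj₁ refl
  zeros-or-one (true  ∷ L) = inj₂ (0 , L , refl)
  zeros-or-one (false ∷ L) with zeros-or-one L
  ... | inj₁ L≡zeros         = inj₁ (cong (false ∷_) L≡zeros)
  ... | inj₂ (a , R , L≡aR) = inj₂ (suc a , R , cong (false ∷_) L≡aR)

  length-zeros-one : ∀ a R → length (replicate a false ++ true ∷ R) ≡ suc (length R + a)
  length-zeros-one zero    R = cong suc (sym (+-identityʳ (length R)))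
  length-zeros-one (suc a) R = trans (cong suc (length-zeros-one a R)) (cong suc (sym (+-suc (length R) a)))

  ConvexWord⇔cyclicRunsOK : ∀ {m} L → length L ≡ suc m → suc (k + k) ≤ suc m →
                            ConvexWord (suc m) L ⇔ (cyclicRunsOK 0 L ≡ true)
  ConvexWord⇔cyclicRunsOK {m} L len 2k<n with zeros-or-one L
  ... | inj₁ L≡zeros = mk⇔
    (λ _ → trans (cong (cyclicRunsOK 0) L≡zeros) (cyclicRunsOK-zeros 0 (length L)))
    (λ _ → subst (ConvexWord (suc m)) (sym L≡zeros)
             (subst (λ c → ConvexWord c (replicate (length L) false)) len (ConvexWord-zeros (length L))))
  ... | inj₂ (a , R , refl) with trans (sym len) (length-zeros-one a R)
  ...   | refl = subst (λ b → ConvexWord (suc m) L ⇔ (b ≡ true)) (sym L-ok≡) (ConvexWord-zeros-one⇔runsOK a R 2k<n)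
    where
    L-ok≡ : cyclicRunsOK 0 (replicate a false ++ true ∷ R) ≡ runsOK 0 a R
    L-ok≡ = trans (cyclicRunsOK-zeros-one 0 a R) (cong (λ t → runsOK 0 t R) (+-identityʳ a))

  ConvexWord-small⇔constant : ∀ {n} L → length L ≡ n → n ≤ suc (k + k) → ConvexWord n L ⇔ (constant L ≡ true)
  ConvexWord-small⇔constant {n} L len n≤ = mk⇔ to from
    where
    to : ConvexWord n L → constant L ≡ true
    to convex with and L in and≡
    ... | true  = ∨-zeroʳ (all not L)
    ... | false with ¬and⇒absent L and≡
    ...   | y , y<L , Ly≡false with convex y (subst (y <_) len y<L) Ly≡false
    ...     | u , _ , _ , zeros = trans (∨-identityʳ (all not L))
                (absent⇒all-not L (λ {i} i<L → zeros i (subst (i <_) len i<L) (dist-≤-small u i n≤)))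
    from : constant L ≡ true → ConvexWord n L
    from ok y y<n Ly≡false with ∨-≡-true {all not L} ok
    ... | inj₁ all-absent = y , y<n , subst (_≤ k) (sym (dist-self n y)) z≤n ,
                            λ z z<n _ → all-not⇒absent L all-absent (subst (z <_) (sym len) z<n)
    ... | inj₂ all-present = contradiction (trans (sym (and⇒present L all-present (subst (y <_) (sym len) y<n))) Ly≡false) λ ()

  module _ {n : ℕ} where

    private
      G = cyclePow n k

    InN⇒dist≤ : ∀ v u → InN G v u → dist n (toℕ v) (toℕ u) ≤ k
    InN⇒dist≤ v .v (inj₁ refl)    = subst (_≤ k) (sym (dist-self n (toℕ v))) z≤n
    InN⇒dist≤ v u  (inj₂ (_ , d≤k)) = d≤k

    dist≤⇒InN : ∀ v u → dist n (toℕ v) (toℕ u) ≤ k → InN G v u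
    dist≤⇒InN v u d≤k with u ≟ᶠ v
    ... | yes u≡v = inj₁ u≡v
    ... | no  u≢v = inj₂ ((λ v≡u → u≢v (sym v≡u)) , d≤k)

    module _ (S : Subset n) where

      private
        L = toList S

        ∈⇒letter : ∀ {x} → x ∈ S → letter L (toℕ x) ≡ true
        ∈⇒letter {x} x∈S = trans (sym (lookup≡letter S x)) ([]=⇒lookup x∈S)

        letter⇒∈ : ∀ {x} → letter L (toℕ x) ≡ true → x ∈ S
        letter⇒∈ {x} present = lookup⇒[]= x S (trans (lookup≡letter S x) present)

        Blocked : Fin n → Set
        Blocked u = ∃ λ (z : Fin n) → dist n (toℕ u) (toℕ z) ≤ k × letter L (toℕ z) ≡ true

        blocked? : ∀ u → Dec (Blocked u)
        blocked? u = any? (λ z → (dist n (toℕ u) (toℕ z) ≤? k) ×-dec (letter L (toℕ z) ≟ᵇ true))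

        dist-fromℕ< : ∀ {a y} (y<n : y < n) → dist n a (toℕ (fromℕ< y<n)) ≡ dist n a y
        dist-fromℕ< {a} y<n = cong (dist n a) (toℕ-fromℕ< y<n)

      ConvexWord⇒DigitallyConvex : ConvexWord n L → DigitallyConvex G S
      ConvexWord⇒DigitallyConvex convex v covered with letter L (toℕ v) in Lv
      ... | true  = letter⇒∈ Lv
      ... | false with convex (toℕ v) (toℕ<n v) Lv
      ...   | u , u<n , u-close , clear with covered (fromℕ< u<n) (dist≤⇒InN v (fromℕ< u<n)
                                                 (subst (_≤ k) (trans (dist-sym n u (toℕ v)) (sym (dist-fromℕ< u<n))) u-close))
      ...     | s , s∈S , u∈N[s] = contradiction (trans (sym (∈⇒letter s∈S)) (clear (toℕ s) (toℕ<n s) s-close)) λ ()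
        where
        s-close : dist n u (toℕ s) ≤ k
        s-close = subst (_≤ k) (trans (dist-sym n (toℕ s) _) (cong (λ i → dist n i (toℕ s)) (toℕ-fromℕ< u<n))) (InN⇒dist≤ s (fromℕ< u<n) u∈N[s])

      DigitallyConvex⇒ConvexWord : DigitallyConvex G S → ConvexWord n L
      DigitallyConvex⇒ConvexWord dc y y<n Ly≡false with any? (λ u → (dist n (toℕ u) y ≤? k) ×-dec ¬? (blocked? u))
      ... | yes (u , u-close , free) = toℕ u , toℕ<n u , u-close , absent
        where
        absent : ∀ z → z < n → dist n (toℕ u) z ≤ k → letter L z ≡ false
        absent z z<n d≤k with letter L z in Lz
        ... | false = refl
        ... | true  = contradiction (fromℕ< z<n , subst (_≤ k) (sym (dist-fromℕ< z<n)) d≤k ,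
                                     trans (cong (letter L) (toℕ-fromℕ< z<n)) Lz) free
      ... | no none = contradiction (trans (sym (∈⇒letter (dc y′ covered))) (trans (cong (letter L) (toℕ-fromℕ< y<n)) Ly≡false)) λ ()
        where
        y′ = fromℕ< y<n
        covered : ∀ u → InN G y′ u → InNS G S u
        covered u u∈N[y] with blocked? u
        ... | yes (z , z-close , Lz) = z , letter⇒∈ Lz , dist≤⇒InN z u (subst (_≤ k) (dist-sym n (toℕ u) (toℕ z)) z-close)
        ... | no  free = contradiction (u , u-close , free) none
          where
          u-close : dist n (toℕ u) y ≤ k
          u-close = subst (_≤ k) (trans (dist-sym n (toℕ y′) (toℕ u)) (cong (dist n (toℕ u)) (toℕ-fromℕ< y<n))) (InN⇒dist≤ y′ u u∈N[y])

-- Counting digitally convex sets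

open import Data.Integer using (ℤ; +_) renaming (_+_ to _+ℤ_; _-_ to _-ℤ_; _*_ to _*ℤ_)
open import Data.Integer.Properties using (pos-+; pos-*)
import Data.Integer.Tactic.RingSolver as ℤ-Solver

+-suc-∸ : ∀ q v → q + suc v ∸ v ≡ suc q
+-suc-∸ q v = trans (cong (_∸ v) (+-suc q v)) (m+n∸n≡m (suc q) v)

ℕ-rec⇒ℤ : ∀ x y z u → x + z ≡ 2 * y + u → + x ≡ (+ 2) *ℤ (+ y) -ℤ (+ z) +ℤ (+ u)
ℕ-rec⇒ℤ x y z u eq = begin
  + x                                ≡⟨ add-sub (+ x) (+ z) ⟩
  + x +ℤ + z -ℤ + z                  ≡⟨ cong (_-ℤ + z) (pos-+ x z) ⟨
  + (x + z) -ℤ + z                   ≡⟨ cong (λ a → + a -ℤ + z) eq ⟩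
  + (2 * y + u) -ℤ + z               ≡⟨ cong (_-ℤ + z) (trans (pos-+ (2 * y) u) (cong (_+ℤ + u) (pos-* 2 y))) ⟩
  (+ 2) *ℤ (+ y) +ℤ + u -ℤ + z       ≡⟨ swap ((+ 2) *ℤ (+ y)) (+ u) (+ z) ⟩
  (+ 2) *ℤ (+ y) -ℤ (+ z) +ℤ (+ u)   ∎
  where
  open ≡-Reasoning
  add-sub : ∀ a b → a ≡ a +ℤ b -ℤ b
  add-sub = ℤ-Solver.solve-∀
  swap : ∀ a b c → a +ℤ b -ℤ c ≡ a -ℤ c +ℤ b
  swap = ℤ-Solver.solve-∀

module _ (k : ℕ) where

  open Runs (k + k)
  open Convexity k
  open ≡-Reasoning

  DigitallyConvex⇔ConvexWord : ∀ {n} (S : Subset n) → DigitallyConvex (cyclePow n k) S ⇔ ConvexWord n (toList S)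
  DigitallyConvex⇔ConvexWord S = mk⇔ (DigitallyConvex⇒ConvexWord S) (ConvexWord⇒DigitallyConvex S)

  nD-cyclePow-small : ∀ {m} → suc m ≤ w → nD (cyclePow (suc m) k) ≡ 2
  nD-cyclePow-small {m} n≤w = trans
    (length-filter-allSubsets-⇔ (suc m) (digitallyConvex? (cyclePow (suc m) k)) (constant ∘ toList)
      (λ S → ⇔-trans (DigitallyConvex⇔ConvexWord S) (ConvexWord-small⇔constant (toList S) (length-toList S) n≤w)))
    (count-constant m)

  nD-cyclePow-large : ∀ {m} → w ≤ suc m → nD (cyclePow (suc m) k) ≡ cyclicCount (suc m)
  nD-cyclePow-large {m} w≤n = begin
    nD (cyclePow (suc m) k)
      ≡⟨ length-filter-allSubsets-⇔ (suc m) (digitallyConvex? (cyclePow (suc m) k)) (cyclicRunsOK 0 ∘ toList)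
           (λ S → ⇔-trans (DigitallyConvex⇔ConvexWord S) (ConvexWord⇔cyclicRunsOK (toList S) (length-toList S) w≤n)) ⟩
    count (suc m) (cyclicRunsOK 0 ∘ toList) ≡⟨ count-cyclicRunsOK (suc m) 0 ⟩
    cyclic (suc m) 0                        ≡⟨ cyclic-0 m ⟩
    cyclicCount (suc m)                     ∎

  nD-cyclePow : ∀ {n} → 1 ≤ n → nD (cyclePow n k) ≡ cyclicCount n
  nD-cyclePow {suc m} _ with suc m ≤? w
  ... | yes n≤w = trans (nD-cyclePow-small n≤w) (sym (cyclicCount-short n≤w))
  ... | no  n≰w = nD-cyclePow-large (<⇒≤ (≰⇒> n≰w))

  2k+≡ : ∀ c → 2 * k + c ≡ c + (k + k)
  2k+≡ c = trans (cong (λ x → k + x + c) (+-identityʳ k)) (+-comm (k + k) c)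

  2k+3+r≡ : ∀ r → 2 * k + 3 + r ≡ 2 + r + w
  2k+3+r≡ = shape k
    where
    shape : ∀ k r → 2 * k + 3 + r ≡ 2 + r + suc (k + k)
    shape = solve-∀

  4k+3≡ : 4 * k + 3 ≡ w + suc w
  4k+3≡ = shape k
    where
    shape : ∀ k → 4 * k + 3 ≡ suc (k + k) + suc (suc (k + k))
    shape = solve-∀

  -- Stated for any f agreeing with cyclicCount, so that the rewrites never unfold nD.
  cyclicCount-shifted-rec : (f : ℕ → ℕ) → (∀ {n} → 1 ≤ n → f n ≡ cyclicCount n) → ∀ n → 2 * k + 3 ≤ n →
                            f n + f (n ∸ 2) ≡ 2 * f (n ∸ 1) + f (n ∸ (2 * k + 2))
  cyclicCount-shifted-rec f f≗ n lo with m≤n⇒∃[o]m+o≡n lo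
  ... | q , refl rewrite 2k+3+r≡ q | 2k+≡ 2 | +-suc-∸ q (k + k)
                       | f≗ {2 + q + w} (s≤s z≤n) | f≗ {q + w} (≤-trans (s≤s z≤n) (m≤n+m w q))
                       | f≗ {1 + q + w} (s≤s z≤n) | f≗ {1 + q} (s≤s z≤n) = cyclicCount-rec q

  nD-cyclePow-short : ∀ {i} → 1 ≤ i → i ≤ 2 * k + 1 → nD (cyclePow i k) ≡ 2
  nD-cyclePow-short {i} 1≤i i≤2k+1 = trans (nD-cyclePow 1≤i) (cyclicCount-short (subst (i ≤_) (2k+≡ 1) i≤2k+1))

  nD-cyclePow-middle : ∀ {j} → 2 * k + 1 ≤ j → j ≤ 4 * k + 3 → nD (cyclePow j k) ≡ 2 + j * (j ∸ (2 * k + 1))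
  nD-cyclePow-middle {j} w≤j hi rewrite 2k+≡ 1 =
    trans (nD-cyclePow (≤-trans (s≤s z≤n) w≤j)) (cyclicCount-middle w≤j (m≤n+o⇒m∸n≤o j w (subst (j ≤_) 4k+3≡ hi)))

  nD-cyclePow-rec : ∀ n → 2 * k + 3 ≤ n →
                    + nD (cyclePow n k) ≡ (+ 2) *ℤ (+ nD (cyclePow (n ∸ 1) k)) -ℤ (+ nD (cyclePow (n ∸ 2) k))
                                          +ℤ (+ nD (cyclePow (n ∸ (2 * k + 2)) k))
  nD-cyclePow-rec n lo = ℕ-rec⇒ℤ (f n) (f (n ∸ 1)) (f (n ∸ 2)) (f (n ∸ (2 * k + 2)))
                                 (cyclicCount-shifted-rec f nD-cyclePow n lo)
    where
    f : ℕ → ℕ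
    f n = nD (cyclePow n k)

  2k+4≤4k+3 : 1 ≤ k → 2 * k + 4 ≤ 4 * k + 3
  2k+4≤4k+3 1≤k = subst₂ _≤_ (shape₁ k) (shape₂ k)
    (+-monoˡ-≤ 3 (+-monoʳ-≤ (2 * k) (≤-trans 1≤k (m≤m+n k (k + 0)))))
    where
    shape₁ : ∀ k → 2 * k + 1 + 3 ≡ 2 * k + 4
    shape₁ = solve-∀
    shape₂ : ∀ k → 2 * k + 2 * k + 3 ≡ 4 * k + 3
    shape₂ = solve-∀

mainTheorem2 : (k : ℕ) → 1 ≤ k →
    ((i : ℕ) → 3 ≤ i → i ≤ 2 * k + 1 → nD (cyclePow i k) ≡ 2)
    × ((j : ℕ) → 2 * k + 2 ≤ j → j ≤ 2 * k + 4 →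
        nD (cyclePow j k) ≡ 2 + j * (j ∸ (2 * k + 1)))
    × ((n : ℕ) → 2 * k + 5 ≤ n →
        + nD (cyclePow n k)
          ≡ (+ 2) *ℤ (+ nD (cyclePow (n ∸ 1) k)) -ℤ (+ nD (cyclePow (n ∸ 2) k))
            +ℤ (+ nD (cyclePow (n ∸ (2 * k + 2)) k)))
mainTheorem2 k 1≤k =
  (λ i 3≤i → nD-cyclePow-short k (≤-trans (s≤s z≤n) 3≤i)) ,
  (λ j lo hi → nD-cyclePow-middle k (≤-trans (+-monoʳ-≤ (2 * k) (n≤1+n 1)) lo) (≤-trans hi (2k+4≤4k+3 k 1≤k))) ,
  (λ n lo → nD-cyclePow-rec k n (≤-trans (+-monoʳ-≤ (2 * k) (s≤s (s≤s (s≤s z≤n)))) lo))
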